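{- There is an absolute constant $c>0$ such that the following holds. Let $p$ be a prime, $r\ge1$ an integer, and $A,B\subset\mathbb{F}_p$ nonempty, where $A$ has distinct consecutive $r$--differences. Then either $A+B=\mathbb{F}_p$ or $$|A+B|\ge c\, e^{ -r(\log 2+1)}\,|A|\,|B|^{1/(r+1)}.$$
   Context: Elements of $\mathbb{F}_p$ are ordered according to their least nonnegative integer representatives, so $A=\{a_1<\dots<a_k\}$ in this order. $A$ has distinct consecutive $r$--differences if the $r$-tuples $(a_{i+1}-a_i,\dots,a_{i+r}-a_{i+r-1})$ (differences computed in $\mathbb{F}_p$), $1\le i\le k-r$, are pairwise distinct. $A+B=\{a+b:a\in A,b\in B\}$. -}

module Defs where

open import Data.Nat as ℕ using (ℕ; zero; suc; _∸_; NonZero)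
open import Data.Nat.DivMod using (_mod_)
open import Data.Integer using (+_)
open import Data.Rational as ℚ using (ℚ; 0ℚ; 1ℚ)
open import Data.Fin as Fin using (Fin; toℕ; inject₁)
open import Data.Fin.Subset using (Subset; _∈_; _∉_)
open import Data.Fin.Subset.Properties using (_∈?_)
open import Data.Fin.Properties using (any?; _≟_)
open import Data.Vec using (tabulate)
open import Data.Product using (_×_; ∃; _,_)
open import Data.Product.Nary.NonDependent using ()
open import Relation.Nullary using (¬_; does)
open import Relation.Nullary.Decidable using (_×-dec_)
open import Relation.Binary.PropositionalEquality using (_≡_)

-- 𝔽_p is modelled as Fin p (elements = least nonnegative representatives
-- 0,…,p-1); its order is the order of Fin (i.e. of the representatives).

_+F_ : ∀ {p} → Fin p → Fin p → Fin p
_+F_ {suc q} a b = (toℕ a ℕ.+ toℕ b) mod (suc q)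

_-F_ : ∀ {p} → Fin p → Fin p → Fin p
_-F_ {suc q} a b = (toℕ a ℕ.+ (suc q ∸ toℕ b)) mod (suc q)

sumset : ∀ {p} → Subset p → Subset p → Subset p
sumset A B = tabulate λ x →
  does (any? λ a → any? λ b → (a ∈? A) ×-dec ((b ∈? B) ×-dec ((a +F b) ≟ x)))

-- These are exactly the
-- windows (a_i, …, a_{i+r}), 1 ≤ i ≤ k - r, of A = {a_1 < … < a_k}.
ConsecWindow : ∀ {p} → Subset p → (r : ℕ) → (Fin (suc r) → Fin p) → Set
ConsecWindow {p} A r v =
  (∀ i → v i ∈ A) ×
  (∀ (j : Fin r) → v (inject₁ j) Fin.< v (Fin.suc j)) ×
  (∀ (j : Fin r) (z : Fin p) → z ∈ A →
     ¬ (v (inject₁ j) Fin.< z × z Fin.< v (Fin.suc j)))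

diffs : ∀ {p} (r : ℕ) → (Fin (suc r) → Fin p) → Fin r → Fin p
diffs r v j = v (Fin.suc j) -F v (inject₁ j)

DistinctConsecDiffs : ∀ {p} → Subset p → ℕ → Set
DistinctConsecDiffs {p} A r =
  ∀ v w → ConsecWindow A r v → ConsecWindow A r w →
  (∀ j → diffs r v j ≡ diffs r w j) → ∀ i → v i ≡ w i

_^ℚ_ : ℚ → ℕ → ℚ
x ^ℚ zero = 1ℚ
x ^ℚ suc n = x ^ℚ n ℚ.* x

ℕ→ℚ : ℕ → ℚ
ℕ→ℚ n = + n ℚ./ 1

expTerm : ℚ → ℕ → ℚ
expTerm x zero = 1ℚ
expTerm x (suc k) = expTerm x k ℚ.* x ℚ.* (+ 1 ℚ./ suc k)

expPartial : ℚ → ℕ → ℚ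
expPartial x zero = 1ℚ
expPartial x (suc m) = expPartial x m ℚ.+ expTerm x (suc m)

-- "X · e^x ≥ Y" (for X ≥ 0, x ≥ 0) for the real number e^x = sup_m expPartial x m:
-- for every rational ε > 0 some partial sum gives X · S_m + ε ≥ Y.
ScaledExpGe : ℚ → ℚ → ℚ → Set
ScaledExpGe X x Y = ∀ (ε : ℚ) → 0ℚ ℚ.< ε → ∃ λ m → Y ℚ.≤ X ℚ.* expPartial x m ℚ.+ ε

{-# OPTIONS --safe #-}
module Submission where

-- Write A = {a₀ < ⋯ < a_{k-1}} and lift A + B to its periodic preimage in ℕ. The rank function
-- of the lift is strictly increasing on it and maps [0, 2p) into [0, M), M = 2|A + B|, so for
-- b ∈ B the sequence f_b(t) = rank(a_t + b) is strictly increasing with values below M.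
-- The n(k - r) windows (f_b(i), …, f_b(i + r)) are pairwise distinct: equal windows give
-- a_{i+j} + b = a_{i'+j} + b' for all j ≤ r, so the windows of A at i and i' have the same
-- consecutive differences, hence coincide, and then i = i', b = b'. Each f_b telescopes, so the
-- spreads f_b(i + r) - f_b(i) add up to at most n r M; by Markov at least half of the windows
-- have spread at most T = ⌊2rM/(k - r)⌋, and at most M T^r increasing windows start below M
-- with all steps at most T. Hence (k - r)^{r+1} |B| ≤ 2M (2rM)^r, which for k ≥ 2r gives
-- |A + B| ≥ |A| |B|^{1/(r+1)} / (8 · 2^r); for k < 2r this follows from |B| ≤ 2|A + B|.

module NatArithmetic where

  open import Data.Nat
  open import Data.Nat.Properties
  open import Data.Nat.DivMod using (m≡m%n+[m/n]*n; m%n<n)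
  open import Data.Nat.Tactic.RingSolver using (solve-∀)
  open import Relation.Binary.PropositionalEquality

  ^-distribʳ-* : ∀ m n o → (m * n) ^ o ≡ m ^ o * n ^ o
  ^-distribʳ-* m n zero    = refl
  ^-distribʳ-* m n (suc o) = trans (cong (m * n *_) (^-distribʳ-* m n o)) (interchange m n (m ^ o) (n ^ o))
    where
    interchange : ∀ a b c d → a * b * (c * d) ≡ a * c * (b * d)
    interchange = solve-∀

  n<2^n : ∀ n → n < 2 ^ n
  n<2^n zero    = z<s
  n<2^n (suc n) = +-mono-≤ (m^n>0 2 n) (≤-trans (n<2^n n) (m≤m+n (2 ^ n) 0))

  m≤m^[1+n] : ∀ m n → m ≤ m ^ suc n
  m≤m^[1+n] zero    n = z≤n
  m≤m^[1+n] (suc m) n = subst (_≤ suc m ^ suc n) (*-identityʳ (suc m)) (*-monoʳ-≤ (suc m) (m^n>0 (suc m) n))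

  m<[1+m/n]*n : ∀ m n .{{_ : NonZero n}} → m < suc (m / n) * n
  m<[1+m/n]*n m n = begin-strict
    m                 ≡⟨ m≡m%n+[m/n]*n m n ⟩
    m % n + m / n * n <⟨ +-monoˡ-< (m / n * n) (m%n<n m n) ⟩
    n + m / n * n     ∎
    where open ≤-Reasoning

  ∸-translation-invariant : ∀ {x₁ x₀ y₁ y₀ c d} → x₁ + c ≡ y₁ + d → x₀ + c ≡ y₀ + d →
                            x₁ ∸ x₀ ≡ y₁ ∸ y₀
  ∸-translation-invariant {x₁} {x₀} {y₁} {y₀} {c} {d} eq₁ eq₀ = begin
    x₁ ∸ x₀              ≡⟨ [m+n]∸[m+o]≡n∸o c x₁ x₀ ⟨
    (c + x₁) ∸ (c + x₀)  ≡⟨ cong₂ _∸_ (+-comm c x₁) (+-comm c x₀) ⟩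
    (x₁ + c) ∸ (x₀ + c)  ≡⟨ cong₂ _∸_ eq₁ eq₀ ⟩
    (y₁ + d) ∸ (y₀ + d)  ≡⟨ cong₂ _∸_ (+-comm y₁ d) (+-comm y₀ d) ⟩
    (d + y₁) ∸ (d + y₀)  ≡⟨ [m+n]∸[m+o]≡n∸o d y₁ y₀ ⟩
    y₁ ∸ y₀              ∎
    where open ≡-Reasoning

  strictMono⇒≤ : ∀ {g : ℕ → ℕ} {n M} → (∀ {u} → suc u < n → g u < g (suc u)) →
                 (∀ {u} → u < n → g u < M) → n ≤ M
  strictMono⇒≤             {n = zero}  _    _     = z≤n
  strictMono⇒≤ {g = g} {n = suc n} incr below = ≤-trans (s≤s (grows n (n<1+n n))) (below (n<1+n n))
    where
    grows : ∀ u → u < suc n → u ≤ g u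
    grows zero    _         = z≤n
    grows (suc u) 1+u<1+n = ≤-<-trans (grows u (<-trans (n<1+n u) 1+u<1+n)) (incr 1+u<1+n)

  few-elements : ∀ {k n m} r → k ≤ r + r → (0 < k → n ≤ m + m) → k ^ suc r * n ≤ (8 * 2 ^ r * m) ^ suc r
  few-elements {zero}           r _     _      = z≤n
  few-elements {suc k} {n} {m} r k≤2r n≤2m[k>0] = begin
    suc k ^ suc r * n                    ≤⟨ *-mono-≤ (^-monoˡ-≤ (suc r) k≤P) n≤4m^[1+r] ⟩
    (2 * 2 ^ r) ^ suc r * (4 * m) ^ suc r ≡⟨ ^-distribʳ-* (2 * 2 ^ r) (4 * m) (suc r) ⟨
    (2 * 2 ^ r * (4 * m)) ^ suc r        ≡⟨ cong (_^ suc r) (regroup (2 ^ r) m) ⟩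
    (8 * 2 ^ r * m) ^ suc r              ∎
    where
    open ≤-Reasoning
    regroup : ∀ a b → 2 * a * (4 * b) ≡ 8 * a * b
    regroup = solve-∀
    double : ∀ a → a + a ≡ 2 * a
    double = solve-∀
    k≤P : suc k ≤ 2 * 2 ^ r
    k≤P = ≤-trans k≤2r (subst (r + r ≤_) (double (2 ^ r)) (+-mono-≤ (<⇒≤ (n<2^n r)) (<⇒≤ (n<2^n r))))
    n≤4m^[1+r] : n ≤ (4 * m) ^ suc r
    n≤4m^[1+r] = ≤-trans (n≤2m[k>0] z<s) (≤-trans 2m≤4m (m≤m^[1+n] (4 * m) r))
      where
      2m≤4m : m + m ≤ 4 * m
      2m≤4m = subst (_≤ 4 * m) (sym (double m)) (*-monoˡ-≤ m {2} {4} (s≤s (s≤s z≤n)))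

  many-elements : ∀ {k n m N} r → k ≤ 2 * N → N ^ suc r * n ≤ 2 * (m + m) * (2 * (r * (m + m))) ^ r →
                  k ^ suc r * n ≤ (8 * 2 ^ r * m) ^ suc r
  many-elements {k} {n} {m} {N} r k≤2N windows = begin
    k ^ suc r * n                          ≤⟨ *-monoˡ-≤ n (^-monoˡ-≤ (suc r) k≤2N) ⟩
    (2 * N) ^ suc r * n                    ≡⟨ cong (_* n) (^-distribʳ-* 2 N (suc r)) ⟩
    2 ^ suc r * N ^ suc r * n              ≡⟨ *-assoc (2 ^ suc r) (N ^ suc r) n ⟩
    2 ^ suc r * (N ^ suc r * n)            ≤⟨ *-monoʳ-≤ (2 ^ suc r) windows ⟩
    2 ^ suc r * (2 * (m + m) * (2 * (r * (m + m))) ^ r)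
      ≤⟨ *-monoʳ-≤ (2 ^ suc r) (*-mono-≤ 4m≤Z (^-monoˡ-≤ r 4rm≤Z)) ⟩
    2 ^ suc r * (Z * Z ^ r)                ≡⟨ ^-distribʳ-* 2 Z (suc r) ⟨
    (2 * Z) ^ suc r                        ≡⟨ cong (_^ suc r) (double (2 ^ r) m) ⟩
    (8 * 2 ^ r * m) ^ suc r                ∎
    where
    open ≤-Reasoning
    Z : ℕ
    Z = 4 * 2 ^ r * m
    regroup : ∀ a b → 2 * (a * (b + b)) ≡ 4 * a * b
    regroup = solve-∀
    double : ∀ a b → 2 * (4 * a * b) ≡ 8 * a * b
    double = solve-∀
    scale : ∀ a → a ≤ 2 ^ r → 2 * (a * (m + m)) ≤ Z
    scale a a≤2^r = subst (_≤ Z) (sym (regroup a m)) (*-monoˡ-≤ m (*-monoʳ-≤ 4 a≤2^r))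
    4m≤Z : 2 * (m + m) ≤ Z
    4m≤Z = subst (_≤ Z) (cong (2 *_) (*-identityˡ (m + m))) (scale 1 (m^n>0 2 r))
    4rm≤Z : 2 * (r * (m + m)) ≤ Z
    4rm≤Z = scale r (<⇒≤ (n<2^n r))

  [8*2^r*m]^[1+r]-expand : ∀ r m → (8 * 2 ^ r * m) ^ suc r ≡ 8 ^ suc r * (m ^ suc r * 2 ^ (r * suc r))
  [8*2^r*m]^[1+r]-expand r m = begin
    (8 * 2 ^ r * m) ^ suc r                 ≡⟨ ^-distribʳ-* (8 * 2 ^ r) m (suc r) ⟩
    (8 * 2 ^ r) ^ suc r * m ^ suc r         ≡⟨ cong (_* m ^ suc r) (^-distribʳ-* 8 (2 ^ r) (suc r)) ⟩
    8 ^ suc r * (2 ^ r) ^ suc r * m ^ suc r ≡⟨ cong (λ x → 8 ^ suc r * x * m ^ suc r) (^-*-assoc 2 r (suc r)) ⟩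
    8 ^ suc r * 2 ^ (r * suc r) * m ^ suc r ≡⟨ swap (8 ^ suc r) (2 ^ (r * suc r)) (m ^ suc r) ⟩
    8 ^ suc r * (m ^ suc r * 2 ^ (r * suc r)) ∎
    where
    open ≡-Reasoning
    swap : ∀ a b c → a * b * c ≡ a * (c * b)
    swap = solve-∀

  markov-halving : ∀ {L s X} T → L * suc T ≤ s * suc T + X → 2 * X ≤ L * suc T → L ≤ 2 * s
  markov-halving {L} {s} {X} T markov 2X≤L[1+T] =
    +-cancelʳ-≤ L L (2 * s) (*-cancelʳ-≤ (L + L) (2 * s + L) (suc T) (begin
      (L + L) * suc T               ≡⟨ double L (suc T) ⟩
      2 * (L * suc T)               ≤⟨ *-monoʳ-≤ 2 markov ⟩
      2 * (s * suc T + X)           ≡⟨ *-distribˡ-+ 2 (s * suc T) X ⟩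
      2 * (s * suc T) + 2 * X       ≤⟨ +-monoʳ-≤ (2 * (s * suc T)) 2X≤L[1+T] ⟩
      2 * (s * suc T) + L * suc T   ≡⟨ regroup s L (suc T) ⟩
      (2 * s + L) * suc T           ∎))
    where
    open ≤-Reasoning
    double : ∀ a b → (a + a) * b ≡ 2 * (a * b)
    double = solve-∀
    regroup : ∀ a b c → 2 * (a * c) + b * c ≡ (2 * a + b) * c
    regroup = solve-∀

module Counting where

  open import Data.Bool using (Bool; true; false)
  open import Data.Nat hiding (_≟_)
  open import Data.Nat.Properties
  open import Data.Fin using (Fin; toℕ; fromℕ<)
  open import Data.Fin.Properties using (toℕ-fromℕ<)
  open import Data.Fin.Subset using (Subset; inside; outside; _∈_; ∣_∣)
  open import Data.Vec using ([]; _∷_; here; there)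
  open import Function using (_∘_)
  open import Relation.Binary.Definitions using (tri<; tri≈; tri>)
  open import Relation.Binary.PropositionalEquality
  open import Relation.Nullary using (contradiction)

  fromBool : Bool → ℕ
  fromBool true  = 1
  fromBool false = 0

  count : (ℕ → Bool) → ℕ → ℕ
  count χ zero    = 0
  count χ (suc n) = fromBool (χ 0) + count (χ ∘ suc) n

  count-mono : ∀ χ {x y} → x ≤ y → count χ x ≤ count χ y
  count-mono χ z≤n       = z≤n
  count-mono χ (s≤s x≤y) = +-monoʳ-≤ (fromBool (χ 0)) (count-mono (χ ∘ suc) x≤y)

  count-strict : ∀ χ {x y} → χ x ≡ true → x < y → count χ x < count χ y
  count-strict χ {zero}  {suc y} χ0≡true _ rewrite χ0≡true = s≤s z≤n
  count-strict χ {suc x} {suc y} χx≡true (s≤s x<y) =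
    +-monoʳ-< (fromBool (χ 0)) (count-strict (χ ∘ suc) χx≡true x<y)

  count-injective : ∀ χ {x y} → χ x ≡ true → χ y ≡ true → count χ x ≡ count χ y → x ≡ y
  count-injective χ {x} {y} χx χy eq with <-cmp x y
  ... | tri< x<y _ _ = contradiction eq (<⇒≢ (count-strict χ χx x<y))
  ... | tri≈ _ x≡y _ = x≡y
  ... | tri> _ _ y<x = contradiction (sym eq) (<⇒≢ (count-strict χ χy y<x))

  count-+ : ∀ χ m n → count χ (m + n) ≡ count χ m + count (λ y → χ (m + y)) n
  count-+ χ zero    n = refl
  count-+ χ (suc m) n = trans (cong (fromBool (χ 0) +_) (count-+ (χ ∘ suc) m n))
                              (sym (+-assoc (fromBool (χ 0)) _ _))

  count-cong : ∀ {χ ψ} n → (∀ {y} → y < n → χ y ≡ ψ y) → count χ n ≡ count ψ n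
  count-cong zero    χ≗ψ = refl
  count-cong (suc n) χ≗ψ = cong₂ _+_ (cong fromBool (χ≗ψ z<s)) (count-cong n (χ≗ψ ∘ s<s))

  χ : ∀ {n} → Subset n → ℕ → Bool
  χ []      _       = false
  χ (x ∷ X) zero    = x
  χ (x ∷ X) (suc y) = χ X y

  χ-true⇒< : ∀ {n} (X : Subset n) {y} → χ X y ≡ true → y < n
  χ-true⇒< (x ∷ X) {zero}  _     = z<s
  χ-true⇒< (x ∷ X) {suc y} χXy = s<s (χ-true⇒< X χXy)

  χ-true⇒∈ : ∀ {n} (X : Subset n) {y} (y<n : y < n) → χ X y ≡ true → fromℕ< y<n ∈ X
  χ-true⇒∈ (x ∷ X) {zero}  _   refl = here
  χ-true⇒∈ (x ∷ X) {suc y} y<n χXy = there (χ-true⇒∈ X (s<s⁻¹ y<n) χXy)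

  ∈⇒χ-true : ∀ {n} {X : Subset n} {z} → z ∈ X → χ X (toℕ z) ≡ true
  ∈⇒χ-true here        = refl
  ∈⇒χ-true (there z∈X) = ∈⇒χ-true z∈X

  count-χ : ∀ {n} (X : Subset n) → count (χ X) n ≡ ∣ X ∣
  count-χ []            = refl
  count-χ (inside  ∷ X) = cong suc (count-χ X)
  count-χ (outside ∷ X) = count-χ X

  -- select X t is the t-th smallest element of X (from t = 0), and n once t ≥ ∣ X ∣.
  select : ∀ {n} → Subset n → ℕ → ℕ
  select []            _       = 0
  select (inside  ∷ X) zero    = 0
  select (inside  ∷ X) (suc t) = suc (select X t)
  select (outside ∷ X) t       = suc (select X t)

  select-≤ : ∀ {n} (X : Subset n) t → select X t ≤ n
  select-≤ []            t       = z≤n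
  select-≤ (inside  ∷ X) zero    = z≤n
  select-≤ (inside  ∷ X) (suc t) = s≤s (select-≤ X t)
  select-≤ (outside ∷ X) t       = s≤s (select-≤ X t)

  select-mono : ∀ {n} (X : Subset n) t → select X t ≤ select X (suc t)
  select-mono []            t       = z≤n
  select-mono (inside  ∷ X) zero    = z≤n
  select-mono (inside  ∷ X) (suc t) = s≤s (select-mono X t)
  select-mono (outside ∷ X) t       = s≤s (select-mono X t)

  select-strict : ∀ {n} (X : Subset n) {t t′} → t < t′ → t′ < ∣ X ∣ → select X t < select X t′
  select-strict (inside  ∷ X) {zero}  {suc t′} _           _            = z<s
  select-strict (inside  ∷ X) {suc t} {suc t′} (s<s t<t′) (s<s t′<∣X∣) = s<s (select-strict X t<t′ t′<∣X∣)
  select-strict (outside ∷ X) t<t′ t′<∣X∣ = s<s (select-strict X t<t′ t′<∣X∣)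

  select-injective : ∀ {n} (X : Subset n) {t t′} → t < ∣ X ∣ → t′ < ∣ X ∣ →
                     select X t ≡ select X t′ → t ≡ t′
  select-injective X {t} {t′} t<∣X∣ t′<∣X∣ eq with <-cmp t t′
  ... | tri< t<t′ _ _ = contradiction eq (<⇒≢ (select-strict X t<t′ t′<∣X∣))
  ... | tri≈ _ t≡t′ _ = t≡t′
  ... | tri> _ _ t′<t = contradiction (sym eq) (<⇒≢ (select-strict X t′<t t<∣X∣))

  select-χ : ∀ {n} (X : Subset n) {t} → t < ∣ X ∣ → χ X (select X t) ≡ true
  select-χ (inside  ∷ X) {zero}  _           = refl
  select-χ (inside  ∷ X) {suc t} (s<s t<∣X∣) = select-χ X t<∣X∣
  select-χ (outside ∷ X) t<∣X∣               = select-χ X t<∣X∣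

  select-< : ∀ {n} (X : Subset n) {t} → t < ∣ X ∣ → select X t < n
  select-< X t<∣X∣ = χ-true⇒< X (select-χ X t<∣X∣)

  select-gap₀ : ∀ {n} (X : Subset n) {y} → y < select X 0 → χ X y ≡ false
  select-gap₀ []            _           = refl
  select-gap₀ (outside ∷ X) {zero}  _   = refl
  select-gap₀ (outside ∷ X) {suc y} (s<s y<) = select-gap₀ X y<

  select-gap : ∀ {n} (X : Subset n) t {y} → select X t < y → y < select X (suc t) → χ X y ≡ false
  select-gap []            t       _         _         = refl
  select-gap (inside  ∷ X) zero    {suc y} _         (s<s y<)  = select-gap₀ X y<
  select-gap (inside  ∷ X) (suc t) {suc y} (s<s lo) (s<s hi) = select-gap X t lo hi
  select-gap (outside ∷ X) t       {suc y} (s<s lo) (s<s hi) = select-gap X t lo hi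

  element : ∀ {n} (X : Subset n) {t} → t < ∣ X ∣ → Fin n
  element X t<∣X∣ = fromℕ< (select-< X t<∣X∣)

  toℕ-element : ∀ {n} (X : Subset n) {t} (t<∣X∣ : t < ∣ X ∣) → toℕ (element X t<∣X∣) ≡ select X t
  toℕ-element X t<∣X∣ = toℕ-fromℕ< (select-< X t<∣X∣)

  element-∈ : ∀ {n} (X : Subset n) {t} (t<∣X∣ : t < ∣ X ∣) → element X t<∣X∣ ∈ X
  element-∈ X t<∣X∣ = χ-true⇒∈ X (select-< X t<∣X∣) (select-χ X t<∣X∣)

module ListCounting where

  open import Data.Nat
  open import Data.Nat.Properties
  open import Data.Nat.ListAction using (sum)
  open import Data.Nat.ListAction.Properties using (sum-++)
  open import Data.List using (List; []; _∷_; _++_; length; map; filter; cartesianProductWith; cartesianProduct)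
  open import Data.List.Properties using (length-++; length-++-sucʳ; length-map; map-++; map-∘; filter-accept; filter-reject)
  open import Data.List.Membership.Propositional using (_∈_)
  open import Data.List.Membership.Propositional.Properties using (∈-∃++; ∈-++⁻; ∈-++⁺ˡ; ∈-++⁺ʳ)
  import Data.List.Relation.Unary.All as All
  open import Data.List.Relation.Unary.AllPairs using (_∷_)
  open import Data.List.Relation.Unary.Any using (here; there)
  open import Data.List.Relation.Unary.Unique.Propositional using (Unique; [])
  open import Data.Product using (_×_; _,_)
  open import Data.Sum using (inj₁; inj₂)
  open import Relation.Binary.PropositionalEquality
  open import Relation.Nullary using (yes; no; contradiction)

  private
    variable
      A B : Set

  ∈-++-∷⁻ : ∀ {v w : A} xs {ys} → v ∈ xs ++ w ∷ ys → v ≢ w → v ∈ xs ++ ys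
  ∈-++-∷⁻ xs v∈ v≢w with ∈-++⁻ xs v∈
  ... | inj₁ v∈xs           = ∈-++⁺ˡ v∈xs
  ... | inj₂ (here v≡w)     = contradiction v≡w v≢w
  ... | inj₂ (there v∈ys)   = ∈-++⁺ʳ xs v∈ys

  injective⇒length≤ : ∀ (f : A → B) {xs} ys → Unique xs →
                      (∀ {x} → x ∈ xs → f x ∈ ys) →
                      (∀ {x x′} → x ∈ xs → x′ ∈ xs → f x ≡ f x′ → x ≡ x′) →
                      length xs ≤ length ys
  injective⇒length≤ f ys [] _ _ = z≤n
  injective⇒length≤ f {x ∷ xs} ys (x∉xs ∷ unique) into inj
    with ys₁ , ys₂ , refl ← ∈-∃++ (into (here refl)) = begin
      suc (length xs)            ≤⟨ s≤s (injective⇒length≤ f (ys₁ ++ ys₂) unique into′ inj′) ⟩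
      suc (length (ys₁ ++ ys₂))  ≡⟨ length-++-sucʳ ys₁ (f x) ys₂ ⟨
      length (ys₁ ++ f x ∷ ys₂)  ∎
    where
    open ≤-Reasoning
    inj′ : ∀ {z z′} → z ∈ xs → z′ ∈ xs → f z ≡ f z′ → z ≡ z′
    inj′ z∈ z′∈ = inj (there z∈) (there z′∈)
    into′ : ∀ {z} → z ∈ xs → f z ∈ ys₁ ++ ys₂
    into′ z∈ = ∈-++-∷⁻ ys₁ (into (there z∈))
      (λ fz≡fx → All.lookup x∉xs z∈ (inj (here refl) (there z∈) (sym fz≡fx)))

  -- Markov's inequality for the elements with s x > T, multiplied out by T + 1
  markov : ∀ (s : A → ℕ) T xs →
           length xs * suc T ≤ length (filter (λ x → s x ≤? T) xs) * suc T + sum (map s xs)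
  markov s T []       = z≤n
  markov s T (x ∷ xs) with s x ≤? T
  ... | yes sx≤T rewrite filter-accept (λ y → s y ≤? T) {xs = xs} sx≤T = begin
      suc T + length xs * suc T           ≤⟨ +-monoʳ-≤ (suc T) (markov s T xs) ⟩
      suc T + (S * suc T + sum (map s xs)) ≤⟨ +-monoʳ-≤ (suc T) (+-monoʳ-≤ (S * suc T) (m≤n+m _ (s x))) ⟩
      suc T + (S * suc T + (s x + sum (map s xs))) ≡⟨ +-assoc (suc T) _ _ ⟨
      suc T + S * suc T + (s x + sum (map s xs)) ∎
    where
    open ≤-Reasoning
    S : ℕ
    S = length (filter (λ y → s y ≤? T) xs)
  ... | no sx≰T rewrite filter-reject (λ y → s y ≤? T) {xs = xs} sx≰T = begin
      suc T + length xs * suc T            ≤⟨ +-mono-≤ (≰⇒> sx≰T) (markov s T xs) ⟩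
      s x + (S * suc T + sum (map s xs))   ≡⟨ +-assoc (s x) _ _ ⟨
      s x + S * suc T + sum (map s xs)     ≡⟨ cong (_+ sum (map s xs)) (+-comm (s x) _) ⟩
      S * suc T + s x + sum (map s xs)     ≡⟨ +-assoc (S * suc T) _ _ ⟩
      S * suc T + (s x + sum (map s xs))   ∎
    where
    open ≤-Reasoning
    S : ℕ
    S = length (filter (λ y → s y ≤? T) xs)

  length-cartesianProductWith : ∀ {C : Set} (f : A → B → C) xs ys →
                                length (cartesianProductWith f xs ys) ≡ length xs * length ys
  length-cartesianProductWith f []       ys = refl
  length-cartesianProductWith f (x ∷ xs) ys =
    trans (length-++ (map (f x) ys)) (cong₂ _+_ (length-map (f x) ys) (length-cartesianProductWith f xs ys))

  sum-cartesianProduct-≤ : ∀ (s : A × B → ℕ) (xs : List A) (ys : List B) {K} →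
                           (∀ x → sum (map (λ y → s (x , y)) ys) ≤ K) →
                           sum (map s (cartesianProduct xs ys)) ≤ length xs * K
  sum-cartesianProduct-≤ s []       ys rows = z≤n
  sum-cartesianProduct-≤ s (x ∷ xs) ys {K} rows = begin
    sum (map s (map (x ,_) ys ++ cartesianProduct xs ys))              ≡⟨ cong sum (map-++ s (map (x ,_) ys) _) ⟩
    sum (map s (map (x ,_) ys) ++ map s (cartesianProduct xs ys))      ≡⟨ sum-++ (map s (map (x ,_) ys)) _ ⟩
    sum (map s (map (x ,_) ys)) + sum (map s (cartesianProduct xs ys)) ≡⟨ cong (λ l → sum l + _) (map-∘ ys) ⟨
    sum (map (λ y → s (x , y)) ys) + sum (map s (cartesianProduct xs ys))
      ≤⟨ +-mono-≤ (rows x) (sum-cartesianProduct-≤ s xs ys rows) ⟩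
    K + length xs * K ∎
    where open ≤-Reasoning

module Windows where

  open import Data.Nat
  open import Data.Nat.Properties
  open import Data.Nat.DivMod using (m/n*n≤m)
  open import Data.Nat.ListAction using (sum)
  open import Data.Nat.Tactic.RingSolver using (solve-∀)
  open import Data.List using (List; []; _∷_; [_]; length; map; filter; upTo; downFrom; cartesianProductWith; cartesianProduct)
  open import Data.List.Properties using (length-map; length-upTo; length-downFrom; ∷-injective)
  open import Data.List.Membership.Propositional using (_∈_)
  open import Data.List.Membership.Propositional.Properties
    using (∈-map⁺; ∈-upTo⁺; ∈-downFrom⁻; ∈-cartesianProductWith⁺; ∈-cartesianProduct⁻; ∈-filter⁻)
  open import Data.List.Relation.Unary.Unique.Propositional.Properties using (cartesianProduct⁺; downFrom⁺; filter⁺)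
  open import Data.Product using (_×_; _,_; proj₁; proj₂)
  open import Data.Sum using (inj₁; inj₂)
  open import Relation.Binary.PropositionalEquality hiding ([_])
  open NatArithmetic
  open ListCounting

  -- window g i r lists g (r + i), …, g (1 + i), g (0 + i): latest value first, so that a window grows by _∷_.
  window : (ℕ → ℕ) → ℕ → ℕ → List ℕ
  window g i r = map (λ j → g (j + i)) (downFrom (suc r))

  head₀ : List ℕ → ℕ
  head₀ []      = 0
  head₀ (x ∷ _) = x

  -- the windows starting below M whose consecutive increments all lie in [1, T]
  box : ℕ → ℕ → ℕ → List (List ℕ)
  box M T zero    = map [_] (upTo M)
  box M T (suc r) = cartesianProductWith (λ w d → head₀ w + suc d ∷ w) (box M T r) (upTo T)

  length-box : ∀ M T r → length (box M T r) ≡ M * T ^ r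
  length-box M T zero    = trans (length-map [_] (upTo M)) (trans (length-upTo M) (sym (*-identityʳ M)))
  length-box M T (suc r) = begin
    length (box M T (suc r))        ≡⟨ length-cartesianProductWith _ (box M T r) (upTo T) ⟩
    length (box M T r) * length (upTo T) ≡⟨ cong₂ _*_ (length-box M T r) (length-upTo T) ⟩
    M * T ^ r * T                   ≡⟨ rotate M (T ^ r) T ⟩
    M * (T * T ^ r)                 ∎
    where
    open ≡-Reasoning
    rotate : ∀ a b c → a * b * c ≡ a * (c * b)
    rotate = solve-∀

  Increasing : (ℕ → ℕ) → ℕ → ℕ → Set
  Increasing g i r = ∀ j → j < r → g (j + i) < g (suc j + i)

  increasing⇒≤ : ∀ g i r → Increasing g i r → g i ≤ g (r + i)
  increasing⇒≤ g i zero    _    = ≤-refl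
  increasing⇒≤ g i (suc r) incr =
    ≤-trans (increasing⇒≤ g i r (λ j j<r → incr j (m<n⇒m<1+n j<r))) (<⇒≤ (incr r (n<1+n r)))

  window-∈-box : ∀ {M T} g i r → g i < M → Increasing g i r → g (r + i) ≤ g i + T →
                 window g i r ∈ box M T r
  window-∈-box g i zero    g<M _ _ = ∈-map⁺ [_] (∈-upTo⁺ g<M)
  window-∈-box {M} {T} g i (suc r) g<M incr spread≤T =
    subst (λ v → v ∷ window g i r ∈ box M T (suc r)) top≡
      (∈-cartesianProductWith⁺ (λ w d → head₀ w + suc d ∷ w)
        (window-∈-box g i r g<M incr′ (≤-trans (<⇒≤ last<top) spread≤T)) (∈-upTo⁺ d<T))
    where
    incr′ : Increasing g i r
    incr′ j j<r = incr j (m<n⇒m<1+n j<r)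
    last<top : g (r + i) < g (suc r + i)
    last<top = incr r (n<1+n r)
    d : ℕ
    d = g (suc r + i) ∸ suc (g (r + i))
    top≡ : g (r + i) + suc d ≡ g (suc r + i)
    top≡ = trans (+-suc (g (r + i)) d) (m+[n∸m]≡n last<top)
    d<T : d < T
    d<T = +-cancelˡ-< (g (r + i)) d T (begin-strict
      g (r + i) + d      <⟨ +-monoʳ-< (g (r + i)) (n<1+n d) ⟩
      g (r + i) + suc d  ≡⟨ top≡ ⟩
      g (suc r + i)      ≤⟨ spread≤T ⟩
      g i + T            ≤⟨ +-monoˡ-≤ T (increasing⇒≤ g i r incr′) ⟩
      g (r + i) + T      ∎)
      where open ≤-Reasoning

  window-injective : ∀ g g′ i i′ r → window g i r ≡ window g′ i′ r →
                     ∀ {j} → j ≤ r → g (j + i) ≡ g′ (j + i′)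
  window-injective g g′ i i′ zero    eq z≤n = proj₁ (∷-injective eq)
  window-injective g g′ i i′ (suc r) eq j≤1+r with m≤n⇒m<n∨m≡n j≤1+r
  ... | inj₂ refl = proj₁ (∷-injective eq)
  ... | inj₁ j<1+r = window-injective g g′ i i′ r (proj₂ (∷-injective eq)) (s≤s⁻¹ j<1+r)

  Monotone : (ℕ → ℕ) → Set
  Monotone g = ∀ t → g t ≤ g (suc t)

  monotone⇒≤ : ∀ {g} → Monotone g → ∀ d t → g t ≤ g (d + t)
  monotone⇒≤ mono zero    t = ≤-refl
  monotone⇒≤ mono (suc d) t = ≤-trans (monotone⇒≤ mono d t) (mono (d + t))

  sum-≤-* : ∀ (h : ℕ → ℕ) {M} r → (∀ j → h j ≤ M) → sum (map h (downFrom r)) ≤ r * M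
  sum-≤-* h zero    _   = z≤n
  sum-≤-* h (suc r) h≤M = +-mono-≤ (h≤M r) (sum-≤-* h r h≤M)

  sum-window-shift : ∀ (g : ℕ → ℕ) r N → g (r + N) + sum (map (λ j → g (j + N)) (downFrom r))
                             ≡ g N + sum (map (λ j → g (j + suc N)) (downFrom r))
  sum-window-shift g zero    N = refl
  sum-window-shift g (suc r) N = begin
    g (suc r + N) + (g (r + N) + Σ)  ≡⟨ cong (g (suc r + N) +_) (sum-window-shift g r N) ⟩
    g (suc r + N) + (g N + Σ′)       ≡⟨ +-assoc (g (suc r + N)) (g N) Σ′ ⟨
    g (suc r + N) + g N + Σ′         ≡⟨ cong (_+ Σ′) (+-comm (g (suc r + N)) (g N)) ⟩
    g N + g (suc r + N) + Σ′         ≡⟨ +-assoc (g N) (g (suc r + N)) Σ′ ⟩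
    g N + (g (suc r + N) + Σ′)       ≡⟨ cong (λ t → g N + (g t + Σ′)) (+-suc r N) ⟨
    g N + (g (r + suc N) + Σ′)       ∎
    where
    open ≡-Reasoning
    Σ : ℕ
    Σ  = sum (map (λ j → g (j + N)) (downFrom r))
    Σ′ : ℕ
    Σ′ = sum (map (λ j → g (j + suc N)) (downFrom r))

  telescope : ∀ {g} → Monotone g → ∀ r N →
              sum (map (λ i → g (r + i) ∸ g i) (downFrom N)) + sum (map (λ j → g (j + 0)) (downFrom r))
              ≡ sum (map (λ j → g (j + N)) (downFrom r))
  telescope         mono r zero    = refl
  telescope {g = g} mono r (suc N) = +-cancelˡ-≡ (g N) _ _ (begin
    g N + (g (r + N) ∸ g N + S + Σ₀) ≡⟨ cong (g N +_) (+-assoc (g (r + N) ∸ g N) S Σ₀) ⟩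
    g N + (g (r + N) ∸ g N + (S + Σ₀)) ≡⟨ cong (λ x → g N + (g (r + N) ∸ g N + x)) (telescope mono r N) ⟩
    g N + (g (r + N) ∸ g N + Σ)      ≡⟨ +-assoc (g N) (g (r + N) ∸ g N) Σ ⟨
    g N + (g (r + N) ∸ g N) + Σ      ≡⟨ cong (_+ Σ) (m+[n∸m]≡n (monotone⇒≤ mono r N)) ⟩
    g (r + N) + Σ                    ≡⟨ sum-window-shift g r N ⟩
    g N + sum (map (λ j → g (j + suc N)) (downFrom r)) ∎)
    where
    open ≡-Reasoning
    S : ℕ
    S  = sum (map (λ i → g (r + i) ∸ g i) (downFrom N))
    Σ₀ : ℕ
    Σ₀ = sum (map (λ j → g (j + 0)) (downFrom r))
    Σ : ℕ
    Σ  = sum (map (λ j → g (j + N)) (downFrom r))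

  spreads-≤ : ∀ {g M} → Monotone g → (∀ t → g t ≤ M) → ∀ r N →
              sum (map (λ i → g (r + i) ∸ g i) (downFrom N)) ≤ r * M
  spreads-≤ {g} {M} mono g≤M r N = begin
    sum (map (λ i → g (r + i) ∸ g i) (downFrom N))                  ≤⟨ m≤m+n _ _ ⟩
    sum (map (λ i → g (r + i) ∸ g i) (downFrom N)) + sum (map (λ j → g (j + 0)) (downFrom r))
                                                                     ≡⟨ telescope mono r N ⟩
    sum (map (λ j → g (j + N)) (downFrom r))                        ≤⟨ sum-≤-* _ r (λ j → g≤M (j + N)) ⟩
    r * M                                                            ∎
    where open ≤-Reasoning

  module DistinctWindows
    (n N r M : ℕ) (f : ℕ → ℕ → ℕ)
    (mono     : ∀ u → Monotone (f u))
    (bounded  : ∀ u t → f u t ≤ M)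
    (strict   : ∀ {u t} → u < n → suc t < r + N → f u t < f u (suc t))
    (distinct : ∀ {u u′ i i′} → u < n → u′ < n → i < N → i′ < N →
                (∀ {j} → j ≤ r → f u (j + i) ≡ f u′ (j + i′)) → u ≡ u′ × i ≡ i′)
    where

    pairs : List (ℕ × ℕ)
    pairs = cartesianProduct (downFrom n) (downFrom N)

    spread : ℕ × ℕ → ℕ
    spread (u , i) = f u (r + i) ∸ f u i

    narrow : ℕ → List (ℕ × ℕ)
    narrow T = filter (λ x → spread x ≤? T) pairs

    shape : ℕ × ℕ → List ℕ
    shape (u , i) = window (f u) i r

    ∈-narrow⁻ : ∀ {T u i} → (u , i) ∈ narrow T → u < n × i < N × spread (u , i) ≤ T
    ∈-narrow⁻ {T} mem with pair∈ , spread≤T ← ∈-filter⁻ (λ x → spread x ≤? T) mem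
                  with u∈ , i∈ ← ∈-cartesianProduct⁻ (downFrom n) (downFrom N) pair∈ =
      ∈-downFrom⁻ u∈ , ∈-downFrom⁻ i∈ , spread≤T

    shape-∈-box : 1 ≤ r → ∀ T {x} → x ∈ narrow T → shape x ∈ box M T r
    shape-∈-box 1≤r T {u , i} mem with u<n , i<N , spread≤T ← ∈-narrow⁻ mem =
      window-∈-box (f u) i r (<-≤-trans (incr 0 1≤r) (bounded u (suc i))) incr
        (≤-trans (m≤n+m∸n (f u (r + i)) (f u i)) (+-monoʳ-≤ (f u i) spread≤T))
      where
      incr : Increasing (f u) i r
      incr j j<r = strict u<n (subst (_≤ r + N) (+-suc (suc j) i) (+-mono-≤ j<r i<N))

    shape-injective : ∀ {T x y} → x ∈ narrow T → y ∈ narrow T → shape x ≡ shape y → x ≡ y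
    shape-injective {T} {u , i} {u′ , i′} x∈ y∈ eq
      with u<n , i<N , _ ← ∈-narrow⁻ x∈ | u′<n , i′<N , _ ← ∈-narrow⁻ y∈
      with refl , refl ← distinct u<n u′<n i<N i′<N (window-injective (f u) (f u′) i i′ r eq) = refl

    length-narrow-≤ : 1 ≤ r → ∀ T → length (narrow T) ≤ M * T ^ r
    length-narrow-≤ 1≤r T = ≤-trans
      (injective⇒length≤ shape (box M T r) (filter⁺ _ (cartesianProduct⁺ (downFrom⁺ n) (downFrom⁺ N)))
        (shape-∈-box 1≤r T) shape-injective)
      (≤-reflexive (length-box M T r))

    markov-pairs : ∀ T → n * N * suc T ≤ length (narrow T) * suc T + n * (r * M)
    markov-pairs T = begin
      n * N * suc T                                           ≡⟨ cong (_* suc T) length-pairs ⟨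
      length pairs * suc T                                    ≤⟨ markov spread T pairs ⟩
      length (narrow T) * suc T + sum (map spread pairs)      ≤⟨ +-monoʳ-≤ _ spreads-total ⟩
      length (narrow T) * suc T + n * (r * M)                 ∎
      where
      open ≤-Reasoning
      length-pairs : length pairs ≡ n * N
      length-pairs = trans (length-cartesianProductWith _,_ (downFrom n) (downFrom N))
                           (cong₂ _*_ (length-downFrom n) (length-downFrom N))
      spreads-total : sum (map spread pairs) ≤ n * (r * M)
      spreads-total = subst (λ k → sum (map spread pairs) ≤ k * (r * M)) (length-downFrom n)
        (sum-cartesianProduct-≤ spread (downFrom n) (downFrom N) (λ u → spreads-≤ (mono u) (bounded u) r N))

    windows-bound : .{{_ : NonZero N}} → 1 ≤ r → N ^ suc r * n ≤ 2 * M * (2 * (r * M)) ^ r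
    windows-bound 1≤r = begin
      N ^ suc r * n                   ≡⟨ rearrange N n (N ^ r) ⟩
      N ^ r * (n * N)                 ≤⟨ *-monoʳ-≤ (N ^ r) half-narrow ⟩
      N ^ r * (2 * length (narrow T)) ≤⟨ *-monoʳ-≤ (N ^ r) (*-monoʳ-≤ 2 (length-narrow-≤ 1≤r T)) ⟩
      N ^ r * (2 * (M * T ^ r))       ≡⟨ regroup (N ^ r) M (T ^ r) ⟩
      2 * M * (T ^ r * N ^ r)         ≡⟨ cong (2 * M *_) (^-distribʳ-* T N r) ⟨
      2 * M * (T * N) ^ r             ≤⟨ *-monoʳ-≤ (2 * M) (^-monoˡ-≤ r (m/n*n≤m (2 * (r * M)) N)) ⟩
      2 * M * (2 * (r * M)) ^ r       ∎
      where
      open ≤-Reasoning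
      -- T N ≤ 2 r M < (T + 1) N, so by Markov at least half of the n N windows are narrow
      T : ℕ
      T = 2 * (r * M) / N
      total≤ : 2 * (n * (r * M)) ≤ n * N * suc T
      total≤ = begin
        2 * (n * (r * M))      ≡⟨ *-comm-middle n (r * M) ⟩
        n * (2 * (r * M))      ≤⟨ *-monoʳ-≤ n (<⇒≤ (m<[1+m/n]*n (2 * (r * M)) N)) ⟩
        n * (suc T * N)        ≡⟨ swap n (suc T) N ⟩
        n * N * suc T          ∎
        where
        *-comm-middle : ∀ a b → 2 * (a * b) ≡ a * (2 * b)
        *-comm-middle = solve-∀
        swap : ∀ a b c → a * (b * c) ≡ a * c * b
        swap = solve-∀
      half-narrow : n * N ≤ 2 * length (narrow T)
      half-narrow = markov-halving {s = length (narrow T)} {X = n * (r * M)} T (markov-pairs T) total≤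
      rearrange : ∀ a b c → a * c * b ≡ c * (b * a)
      rearrange = solve-∀
      regroup : ∀ a b c → a * (2 * (b * c)) ≡ 2 * b * (c * a)
      regroup = solve-∀

module Sumsets where

  open import Defs
  open import Data.Bool using (Bool; true)
  open import Data.Nat hiding (_≟_)
  open import Data.Nat.Properties hiding (_≟_)
  open import Data.Nat.DivMod using (m%n<n; m<n⇒m%n≡m; [m+n]%n≡m%n)
  open import Data.Fin as Fin using (Fin; toℕ; inject₁)
  open import Data.Fin.Properties using (any?; _≟_; toℕ<n; toℕ-fromℕ<; toℕ-inject₁; toℕ-injective)
  open import Data.Fin.Subset using (Subset; _∈_; ∣_∣)
  open import Data.Fin.Subset.Properties using (_∈?_)
  open import Data.Vec using ([])
  open import Data.Vec.Properties using (lookup∘tabulate; lookup⇒[]=)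
  open import Data.Product using (_×_; _,_; ∃)
  open import Relation.Binary.PropositionalEquality
  open import Relation.Nullary using (¬_; Dec; does; yes; no)
  open import Relation.Nullary.Decidable using (_×-dec_; dec-true)
  open NatArithmetic
  open Counting
  open Windows using (Monotone; module DistinctWindows)

  module _ {q : ℕ} where

    toℕ-+F : (x y : Fin (suc q)) → toℕ (x +F y) ≡ (toℕ x + toℕ y) % suc q
    toℕ-+F x y = toℕ-fromℕ< (m%n<n (toℕ x + toℕ y) (suc q))

    toℕ--F : (x y : Fin (suc q)) → toℕ y ≤ toℕ x → toℕ (x -F y) ≡ toℕ x ∸ toℕ y
    toℕ--F x y y≤x = begin
      toℕ (x -F y)                             ≡⟨ toℕ-fromℕ< (m%n<n (toℕ x + (suc q ∸ toℕ y)) (suc q)) ⟩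
      (toℕ x + (suc q ∸ toℕ y)) % suc q        ≡⟨ cong (_% suc q) (+-∸-assoc (toℕ x) (<⇒≤ (toℕ<n y))) ⟨
      (toℕ x + suc q ∸ toℕ y) % suc q          ≡⟨ cong (_% suc q) (+-∸-comm (suc q) y≤x) ⟩
      (toℕ x ∸ toℕ y + suc q) % suc q          ≡⟨ [m+n]%n≡m%n (toℕ x ∸ toℕ y) (suc q) ⟩
      (toℕ x ∸ toℕ y) % suc q                  ≡⟨ m<n⇒m%n≡m (≤-<-trans (m∸n≤m (toℕ x) (toℕ y)) (toℕ<n x)) ⟩
      toℕ x ∸ toℕ y                            ∎
      where open ≡-Reasoning

    sum? : (A B : Subset (suc q)) (z : Fin (suc q)) → Dec (∃ λ x → ∃ λ y → x ∈ A × y ∈ B × x +F y ≡ z)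
    sum? A B z = any? λ x → any? λ y → (x ∈? A) ×-dec ((y ∈? B) ×-dec ((x +F y) ≟ z))

    +F-∈-sumset : ∀ (A B : Subset (suc q)) {x y} → x ∈ A → y ∈ B → x +F y ∈ sumset A B
    +F-∈-sumset A B {x} {y} x∈A y∈B = lookup⇒[]= (x +F y) (sumset A B)
      (trans (lookup∘tabulate (λ z → does (sum? A B z)) (x +F y)) (dec-true (sum? A B (x +F y)) (x , y , x∈A , y∈B , refl)))

  module SumsetWindows {q : ℕ} (A B : Subset (suc q)) (r : ℕ) where

    k n m : ℕ
    k = ∣ A ∣
    n = ∣ B ∣
    m = ∣ sumset A B ∣

    a b : ℕ → ℕ
    a = select A
    b = select B

    lifted : ℕ → Bool
    lifted y = χ (sumset A B) (y % suc q)

    rank : ℕ → ℕ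
    rank = count lifted

    M : ℕ
    M = rank (suc q + suc q)

    f : ℕ → ℕ → ℕ
    f u t = rank (a t + b u)

    M≡m+m : M ≡ m + m
    M≡m+m = trans (count-+ lifted (suc q) (suc q)) (cong₂ _+_ lower-copy upper-copy)
      where
      lower-copy : count lifted (suc q) ≡ m
      lower-copy = trans (count-cong (suc q) λ y<p → cong (χ (sumset A B)) (m<n⇒m%n≡m y<p))
                         (count-χ (sumset A B))
      upper-copy : count (λ y → lifted (suc q + y)) (suc q) ≡ m
      upper-copy = trans (count-cong (suc q) λ {y} y<p → cong (χ (sumset A B))
                           (trans (cong (_% suc q) (+-comm (suc q) y)) (trans ([m+n]%n≡m%n y (suc q)) (m<n⇒m%n≡m y<p))))
                         (count-χ (sumset A B))

    lifted-sum : ∀ {t u} → t < k → u < n → lifted (a t + b u) ≡ true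
    lifted-sum t<k u<n =
      subst (λ z → χ (sumset A B) z ≡ true)
        (trans (toℕ-+F (element A t<k) (element B u<n))
               (cong₂ (λ x y → (x + y) % suc q) (toℕ-element A t<k) (toℕ-element B u<n)))
        (∈⇒χ-true (+F-∈-sumset A B (element-∈ A t<k) (element-∈ B u<n)))

    f-mono : ∀ u → Monotone (f u)
    f-mono u t = count-mono lifted (+-monoˡ-≤ (b u) (select-mono A t))

    f-bounded : ∀ u t → f u t ≤ M
    f-bounded u t = count-mono lifted (+-mono-≤ (select-≤ A t) (select-≤ B u))

    f-strict : ∀ {u t} → u < n → suc t < k → f u t < f u (suc t)
    f-strict u<n 1+t<k = count-strict lifted (lifted-sum (<-trans (n<1+n _) 1+t<k) u<n)
                                             (+-monoˡ-< _ (select-strict A (n<1+n _) 1+t<k))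

    same-rank⇒same-sum : ∀ {u u′ t t′} → u < n → u′ < n → t < k → t′ < k →
                         f u t ≡ f u′ t′ → a t + b u ≡ a t′ + b u′
    same-rank⇒same-sum u<n u′<n t<k t′<k = count-injective lifted (lifted-sum t<k u<n) (lifted-sum t′<k u′<n)

    n≤M : 0 < k → n ≤ M
    n≤M 0<k = strictMono⇒≤ {g = λ u → f u 0}
      (λ 1+u<n → count-strict lifted (lifted-sum 0<k (<-trans (n<1+n _) 1+u<n))
                                     (+-monoʳ-< (a 0) (select-strict B (n<1+n _) 1+u<n)))
      (λ u<n → count-strict lifted (lifted-sum 0<k u<n) (+-mono-< (select-< A 0<k) (select-< B u<n)))

    module _ (r≤k : r ≤ k) where

      N : ℕ
      N = k ∸ r

      r+N≡k : r + N ≡ k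
      r+N≡k = m+[n∸m]≡n r≤k

      index-< : ∀ {i j} → i < N → j ≤ r → j + i < k
      index-< {i} i<N j≤r = ≤-<-trans (+-monoˡ-≤ i j≤r) (subst (r + i <_) r+N≡k (+-monoʳ-< r i<N))

      run : ∀ {i} → i < N → Fin (suc r) → Fin (suc q)
      run i<N j = element A (index-< i<N (s≤s⁻¹ (toℕ<n j)))

      toℕ-run : ∀ {i} (i<N : i < N) j → toℕ (run i<N j) ≡ a (toℕ j + i)
      toℕ-run i<N j = toℕ-element A (index-< i<N (s≤s⁻¹ (toℕ<n j)))

      toℕ-run-inject₁ : ∀ {i} (i<N : i < N) j → toℕ (run i<N (inject₁ j)) ≡ a (toℕ j + i)
      toℕ-run-inject₁ {i} i<N j = trans (toℕ-run i<N (inject₁ j)) (cong (λ x → a (x + i)) (toℕ-inject₁ j))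

      run-step : ∀ {i} (i<N : i < N) j → run i<N (inject₁ j) Fin.< run i<N (Fin.suc j)
      run-step i<N j = subst₂ _<_ (sym (toℕ-run-inject₁ i<N j)) (sym (toℕ-run i<N (Fin.suc j)))
                              (select-strict A (n<1+n _) (index-< i<N (toℕ<n j)))

      run-consecutive : ∀ {i} (i<N : i < N) → ConsecWindow A r (run i<N)
      run-consecutive {i} i<N = (λ j → element-∈ A (index-< i<N (s≤s⁻¹ (toℕ<n j)))) , run-step i<N , gap
        where
        gap : ∀ j z → z ∈ A → ¬ (run i<N (inject₁ j) Fin.< z × z Fin.< run i<N (Fin.suc j))
        gap j z z∈A (above , below)
          with trans (sym (∈⇒χ-true z∈A))
                     (select-gap A (toℕ j + i) (subst (_< toℕ z) (toℕ-run-inject₁ i<N j) above)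
                                               (subst (toℕ z <_) (toℕ-run i<N (Fin.suc j)) below))
        ... | ()

      toℕ-diffs-run : ∀ {i} (i<N : i < N) j → toℕ (diffs r (run i<N) j) ≡ a (suc (toℕ j + i)) ∸ a (toℕ j + i)
      toℕ-diffs-run i<N j = trans (toℕ--F _ _ (<⇒≤ (run-step i<N j)))
                                  (cong₂ _∸_ (toℕ-run i<N (Fin.suc j)) (toℕ-run-inject₁ i<N j))

      f-distinct : DistinctConsecDiffs A r → ∀ {u u′ i i′} → u < n → u′ < n → i < N → i′ < N →
                   (∀ {j} → j ≤ r → f u (j + i) ≡ f u′ (j + i′)) → u ≡ u′ × i ≡ i′
      f-distinct dcd {u} {u′} {i} {i′} u<n u′<n i<N i′<N same-ranks = u≡u′ , i≡i′
        where
        sums : ∀ {j} → j ≤ r → a (j + i) + b u ≡ a (j + i′) + b u′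
        sums j≤r = same-rank⇒same-sum u<n u′<n (index-< i<N j≤r) (index-< i′<N j≤r) (same-ranks j≤r)
        same-diffs : ∀ j → diffs r (run i<N) j ≡ diffs r (run i′<N) j
        same-diffs j = toℕ-injective (trans (toℕ-diffs-run i<N j)
          (trans (∸-translation-invariant {a (suc (toℕ j + i))} {a (toℕ j + i)} {a (suc (toℕ j + i′))} {a (toℕ j + i′)}
                   (sums (toℕ<n j)) (sums (<⇒≤ (toℕ<n j)))) (sym (toℕ-diffs-run i′<N j))))
        same-start : a i ≡ a i′
        same-start = trans (sym (toℕ-run i<N Fin.zero))
          (trans (cong toℕ (dcd _ _ (run-consecutive i<N) (run-consecutive i′<N) same-diffs Fin.zero))
                 (toℕ-run i′<N Fin.zero))
        i≡i′ : i ≡ i′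
        i≡i′ = select-injective A (index-< i<N z≤n) (index-< i′<N z≤n) same-start
        u≡u′ : u ≡ u′
        u≡u′ = select-injective B u<n u′<n
          (+-cancelˡ-≡ (a i) _ _ (trans (sums z≤n) (cong (_+ b u′) (sym same-start))))

      windows-bound : 1 ≤ r → r ≤ N → DistinctConsecDiffs A r → N ^ suc r * n ≤ 2 * M * (2 * (r * M)) ^ r
      windows-bound 1≤r r≤N dcd =
        DistinctWindows.windows-bound n N r M f f-mono f-bounded strict (f-distinct dcd)
          {{>-nonZero (≤-trans 1≤r r≤N)}} 1≤r
        where
        strict : ∀ {u t} → u < n → suc t < r + N → f u t < f u (suc t)
        strict u<n 1+t<r+N = f-strict u<n (subst (suc _ <_) r+N≡k 1+t<r+N)

    bound : 1 ≤ r → DistinctConsecDiffs A r → k ^ suc r * n ≤ (8 * 2 ^ r * m) ^ suc r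
    bound 1≤r dcd with r + r ≤? k
    ... | yes 2r≤k = many-elements {N = N r≤k} r k≤2N
          (subst (λ M′ → N r≤k ^ suc r * n ≤ 2 * M′ * (2 * (r * M′)) ^ r) M≡m+m (windows-bound r≤k 1≤r r≤N dcd))
      where
      r≤k : r ≤ k
      r≤k = ≤-trans (m≤m+n r r) 2r≤k
      r≤N : r ≤ N r≤k
      r≤N = m+n≤o⇒m≤o∸n r 2r≤k
      k≤2N : k ≤ 2 * N r≤k
      k≤2N = subst₂ _≤_ (r+N≡k r≤k) (cong (N r≤k +_) (sym (+-identityʳ (N r≤k)))) (+-monoˡ-≤ (N r≤k) r≤N)
    ... | no 2r≰k = few-elements r (<⇒≤ (≰⇒> 2r≰k)) (λ 0<k → subst (n ≤_) M≡m+m (n≤M 0<k))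

  sumset-bound : ∀ {p} r → 1 ≤ r → (A B : Subset p) → DistinctConsecDiffs A r →
                 ∣ A ∣ ^ suc r * ∣ B ∣ ≤ 8 ^ suc r * (∣ sumset A B ∣ ^ suc r * 2 ^ (r * suc r))
  sumset-bound {zero}  r _   [] B _   = z≤n
  sumset-bound {suc q} r 1≤r A  B dcd =
    subst (∣ A ∣ ^ suc r * ∣ B ∣ ≤_) ([8*2^r*m]^[1+r]-expand r _) (SumsetWindows.bound A B r 1≤r dcd)

module ScaledExp where

  open import Defs
  open import Data.Nat as ℕ using (zero; suc)
  import Data.Nat.Properties as ℕ
  open import Data.Integer as ℤ using (+_; +≤+)
  import Data.Integer.Properties as ℤ
  open import Data.Nat.Coprimality using (1-coprimeTo) renaming (sym to coprime-sym)
  open import Data.Rational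
  open import Data.Rational.Properties
  open import Data.Unit using (tt)
  open import Data.Product using (_,_)
  open import Relation.Binary.PropositionalEquality
  open import Relation.Nullary.Decidable using (toWitness)
  open import Algebra.Bundles using (CommutativeRing)
  open import Algebra.Properties.CommutativeSemigroup (CommutativeRing.*-commutativeSemigroup +-*-commutativeRing)
    using (interchange)

  c : ℚ
  c = + 1 / 8

  0<c : 0ℚ < c
  0<c = toWitness {a? = 0ℚ <? c} tt

  ℕ→ℚ≡mkℚ : ∀ n → ℕ→ℚ n ≡ mkℚ (+ n) 0 (coprime-sym (1-coprimeTo n))
  ℕ→ℚ≡mkℚ n = normalize-coprime (coprime-sym (1-coprimeTo n))

  ℕ→ℚ-* : ∀ m n → ℕ→ℚ (m ℕ.* n) ≡ ℕ→ℚ m * ℕ→ℚ n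
  ℕ→ℚ-* m n = trans (cong (_/ 1) (sym (ℤ.+◃n≡+n (m ℕ.* n)))) (sym (cong₂ _*_ (ℕ→ℚ≡mkℚ m) (ℕ→ℚ≡mkℚ n)))

  ℕ→ℚ-mono : ∀ {m n} → m ℕ.≤ n → ℕ→ℚ m ≤ ℕ→ℚ n
  ℕ→ℚ-mono {m} {n} m≤n = subst₂ _≤_ (sym (ℕ→ℚ≡mkℚ m)) (sym (ℕ→ℚ≡mkℚ n))
    (*≤* (subst₂ ℤ._≤_ (sym (ℤ.*-identityʳ (+ m))) (sym (ℤ.*-identityʳ (+ n))) (+≤+ m≤n)))

  c^n*8^n≡1 : ∀ n → c ^ℚ n * ℕ→ℚ (8 ℕ.^ n) ≡ 1ℚ
  c^n*8^n≡1 zero    = refl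
  c^n*8^n≡1 (suc n) = begin
    c ^ℚ n * c * ℕ→ℚ (8 ℕ.* 8 ℕ.^ n)        ≡⟨ cong (λ x → c ^ℚ n * c * ℕ→ℚ x) (ℕ.*-comm 8 (8 ℕ.^ n)) ⟩
    c ^ℚ n * c * ℕ→ℚ (8 ℕ.^ n ℕ.* 8)        ≡⟨ cong (c ^ℚ n * c *_) (ℕ→ℚ-* (8 ℕ.^ n) 8) ⟩
    c ^ℚ n * c * (ℕ→ℚ (8 ℕ.^ n) * ℕ→ℚ 8)   ≡⟨ interchange (c ^ℚ n) c (ℕ→ℚ (8 ℕ.^ n)) (ℕ→ℚ 8) ⟩
    c ^ℚ n * ℕ→ℚ (8 ℕ.^ n) * (c * ℕ→ℚ 8)   ≡⟨ cong (_* (c * ℕ→ℚ 8)) (c^n*8^n≡1 n) ⟩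
    1ℚ * (c * ℕ→ℚ 8)                        ≡⟨⟩
    1ℚ                                      ∎
    where open ≡-Reasoning

  c^n≥0 : ∀ n → NonNegative (c ^ℚ n)
  c^n≥0 zero    = _
  c^n≥0 (suc n) = nonNeg*nonNeg⇒nonNeg (c ^ℚ n) {{c^n≥0 n}} c

  -- The partial sum e^x ≥ 1 already suffices: the bound on ℕ carries no factor e^{r(r+1)}.
  scaledExpGe-of-≤ : ∀ s {X Y} x → Y ℕ.≤ 8 ℕ.^ s ℕ.* X → ScaledExpGe (ℕ→ℚ X) x (c ^ℚ s * ℕ→ℚ Y)
  scaledExpGe-of-≤ s {X} {Y} x Y≤8^sX ε ε>0 = 0 , (begin
    c ^ℚ s * ℕ→ℚ Y                     ≤⟨ *-monoˡ-≤-nonNeg (c ^ℚ s) {{c^n≥0 s}} (ℕ→ℚ-mono Y≤8^sX) ⟩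
    c ^ℚ s * ℕ→ℚ (8 ℕ.^ s ℕ.* X)       ≡⟨ cong (c ^ℚ s *_) (ℕ→ℚ-* (8 ℕ.^ s) X) ⟩
    c ^ℚ s * (ℕ→ℚ (8 ℕ.^ s) * ℕ→ℚ X)  ≡⟨ *-assoc (c ^ℚ s) _ _ ⟨
    c ^ℚ s * ℕ→ℚ (8 ℕ.^ s) * ℕ→ℚ X    ≡⟨ cong (_* ℕ→ℚ X) (c^n*8^n≡1 s) ⟩
    1ℚ * ℕ→ℚ X                         ≡⟨ *-comm 1ℚ (ℕ→ℚ X) ⟩
    ℕ→ℚ X * 1ℚ                         ≡⟨ +-identityʳ _ ⟨
    ℕ→ℚ X * 1ℚ + 0ℚ                    ≤⟨ +-monoʳ-≤ (ℕ→ℚ X * 1ℚ) (<⇒≤ ε>0) ⟩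
    ℕ→ℚ X * 1ℚ + ε                     ∎)
    where open ≤-Reasoning

open import Defs
open import Data.Nat using (ℕ; _≤_; _^_; _*_; suc)
open import Data.Nat.Primality using (Prime)
open import Data.Rational using (ℚ; 0ℚ; _<_)
open import Data.Fin using (Fin)
open import Data.Fin.Subset using (Subset; Nonempty; ∣_∣; _∈_)
open import Data.Product using (Σ; _×_; _,_)
open import Data.Sum using (_⊎_; inj₂)

theorem1p3 : Σ ℚ λ c → 0ℚ < c ×
    (∀ (p : ℕ) → Prime p → ∀ (r : ℕ) → 1 ≤ r → ∀ (A B : Subset p) →
      Nonempty A → Nonempty B → DistinctConsecDiffs A r →
      (∀ (x : Fin p) → x ∈ sumset A B)
      ⊎ ScaledExpGe (ℕ→ℚ (∣ sumset A B ∣ ^ suc r * 2 ^ (r * suc r))) (ℕ→ℚ (r * suc r))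
                    ((c ^ℚ suc r) Data.Rational.* ℕ→ℚ (∣ A ∣ ^ suc r * ∣ B ∣)))
theorem1p3 = ScaledExp.c , ScaledExp.0<c , λ p _ r 1≤r A B _ _ dcd →
  inj₂ (ScaledExp.scaledExpGe-of-≤ (suc r) _ (Sumsets.sumset-bound r 1≤r A B dcd))
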